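{- Let $a \ge 2$ and $n > a$ be integers, and for $1 \le j \le a-1$ and $N \in \{n-1, n\}$ let $\tilde{h}_j^{N}$ denote the Boolean function $x_j x_{N-a+1+j}$ in $N$ variables. For a Boolean function $u$ and integer $b \ge 0$, let $T^c_b(u)$ denote the $c$-th of the $2^b$ consecutive equal-sized pieces into which the truth table $T(u)$ is divided. Then for $1 \le j \le a-1$, $$T(\tilde{h}^n_j) = T^1_j(\tilde{h}^{n-1}_j) \,\|\, T^1_j(\tilde{h}^{n-1}_j) \,\|\, T^2_j(\tilde{h}^{n-1}_j) \,\|\, T^2_j(\tilde{h}^{n-1}_j) \,\|\, \cdots \,\|\, T^{2^j}_j(\tilde{h}^{n-1}_j) \,\|\, T^{2^j}_j(\tilde{h}^{n-1}_j),$$ i.e. each of the $2^j$ pieces of $T(\tilde{h}_j^{n-1})$ appears twice in succession.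
   Context: The truth table $T(f)$ of a Boolean function $f$ in $N$ variables is the sequence $(f(v_0), \ldots, f(v_{2^N-1}))$ with $v_0=(0,\ldots,0), v_1=(0,\ldots,0,1),\ldots$ listing $GF(2)^N$ in lexicographic order. $\|$ denotes concatenation. -}

module Defs where

open import Data.Nat using (ℕ; zero; suc; _+_; _∸_; _^_; _/_)
open import Data.Bool using (Bool; true; false; _∧_)
open import Data.List using (List; []; _∷_; _++_; map; take; drop; length; concatMap)
open import Data.Vec using (Vec; []; _∷_)
open import Data.Nat.Properties using (m^n≢0)

BoolFun : ℕ → Set
BoolFun N = Vec Bool N → Bool

-- GF(2)^N listed in lexicographic order: v₀ = (0,…,0), v₁ = (0,…,0,1), …
-- (the first coordinate x₁ is the most significant one).
lexVecs : (N : ℕ) → List (Vec Bool N)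
lexVecs zero = [] ∷ []
lexVecs (suc N) = map (false ∷_) (lexVecs N) ++ map (true ∷_) (lexVecs N)

T : {N : ℕ} → BoolFun N → List Bool
T {N} f = map f (lexVecs N)

-- The i-th variable x_i (1-indexed); out-of-range indices give false
-- (they never occur in the statement under its hypotheses).
var : {N : ℕ} → ℕ → Vec Bool N → Bool
var i [] = false
var zero (x ∷ v) = false
var (suc zero) (x ∷ v) = x
var (suc (suc i)) (x ∷ v) = var (suc i) v

htilde : (a j N : ℕ) → BoolFun N
htilde a j N v = var j v ∧ var (N ∸ a + 1 + j) v

chunks : ℕ → ℕ → List Bool → List (List Bool)
chunks zero s xs = []
chunks (suc k) s xs = take s xs ∷ chunks k s (drop s xs)

pieces : {N : ℕ} → ℕ → BoolFun N → List (List Bool)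
pieces {N} b u = chunks (2 ^ b) ((length (T u) / 2 ^ b) {{m^n≢0 2 b}}) (T u)

doublePieces : List (List Bool) -> List Bool
doublePieces = concatMap (λ p → p ++ p)

module Submission where

-- Write n = N + 1.  The function h̃ⁿ_j = x_j x_{n-a+1+j} does not read
-- the variable x_{j+1} (its second variable has index n-a+1+j ≥ j+2), and
-- erasing that variable turns it into h̃^{n-1}_j.  So the theorem is an
-- instance of a general fact about any f in N+1 variables that ignores
-- coordinate j (counted from 0) and reduces to g when it is deleted:
--   T(f) = T¹_j(g) ‖ T¹_j(g) ‖ ⋯ ‖ T^{2^j}_j(g) ‖ T^{2^j}_j(g).
-- To prove it, the pieces T^c_j(g) are identified with the "blocks" of g,
-- the truth tables of the 2^j subfunctions obtained by fixing x₁ … x_j in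
-- lexicographic order; blocks come with a clean recursion on the first
-- variable, along which the general fact is proved by induction on j.

open import Defs
open import Data.Nat using (ℕ; zero; suc; _+_; _*_; _∸_; _^_; _/_; _≤_; _<_; s≤s)
open import Data.Nat.Properties
  using (m^n≢0; *-identityˡ; ^-distribˡ-+-*; m∸n+n≡m; +-∸-assoc; +-comm; m≤n+m; m∸n≤m; n<1+n; n≤1+n; ≤-trans)
open import Data.Nat.DivMod using (m*n/n≡m)
open import Data.Bool using (Bool; true; false; _∧_)
open import Data.List using (List; []; _∷_; _++_; map; take; drop; length; concat)
open import Data.List.Properties
  using (map-++; map-∘; map-cong; length-map; length-++; concat-++; concatMap-++; ++-identityʳ)
open import Data.List.Relation.Unary.All using (All; []; _∷_)
open import Data.List.Relation.Unary.All.Properties using (++⁺)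
open import Data.Vec using (Vec; []; _∷_)
open import Relation.Binary.PropositionalEquality
  using (_≡_; refl; sym; trans; cong; cong₂; module ≡-Reasoning)
open ≡-Reasoning

take-length-++ : {A : Set} (xs ys : List A) → take (length xs) (xs ++ ys) ≡ xs
take-length-++ []       ys = refl
take-length-++ (x ∷ xs) ys = cong (x ∷_) (take-length-++ xs ys)

drop-length-++ : {A : Set} (xs ys : List A) → drop (length xs) (xs ++ ys) ≡ ys
drop-length-++ []       ys = refl
drop-length-++ (x ∷ xs) ys = drop-length-++ xs ys

chunks-concat : (bs : List (List Bool)) (s : ℕ) →
  All (λ b → length b ≡ s) bs → chunks (length bs) s (concat bs) ≡ bs
chunks-concat []       s []           = refl
chunks-concat (b ∷ bs) s (refl ∷ lbs) = cong₂ _∷_ (take-length-++ b (concat bs))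
  (trans (cong (chunks (length bs) (length b)) (drop-length-++ b (concat bs)))
         (chunks-concat bs (length b) lbs))

doublePieces-++ : (xs ys : List (List Bool)) →
  doublePieces (xs ++ ys) ≡ doublePieces xs ++ doublePieces ys
doublePieces-++ = concatMap-++ (λ p → p ++ p)

cofactor : {N : ℕ} → Bool → BoolFun (suc N) → BoolFun N
cofactor b f v = f (b ∷ v)

-- Lexicographic order lists first all vectors with x₁ = 0, then those with
-- x₁ = 1, so a truth table is the table of its two cofactors in turn.
T-cofactors : {N : ℕ} (f : BoolFun (suc N)) → T f ≡ T (cofactor false f) ++ T (cofactor true f)
T-cofactors {N} f = begin
  map f (map (false ∷_) (lexVecs N) ++ map (true ∷_) (lexVecs N))
    ≡⟨ map-++ f (map (false ∷_) (lexVecs N)) (map (true ∷_) (lexVecs N)) ⟩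
  map f (map (false ∷_) (lexVecs N)) ++ map f (map (true ∷_) (lexVecs N))
    ≡⟨ sym (cong₂ _++_ (map-∘ (lexVecs N)) (map-∘ (lexVecs N))) ⟩
  T (cofactor false f) ++ T (cofactor true f) ∎

length-lexVecs : (N : ℕ) → length (lexVecs N) ≡ 2 ^ N
length-lexVecs zero    = refl
length-lexVecs (suc N) =
  trans (length-++ (map (false ∷_) (lexVecs N)))
        (cong₂ _+_ half (trans half (sym (*-identityˡ (2 ^ N)))))
  where
  half : {b : Bool} → length (map (b ∷_) (lexVecs N)) ≡ 2 ^ N
  half = trans (length-map _ (lexVecs N)) (length-lexVecs N)

length-T : {N : ℕ} (f : BoolFun N) → length (T f) ≡ 2 ^ N
length-T {N} f = trans (length-map f (lexVecs N)) (length-lexVecs N)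

-- The j-blocks of f: the truth tables of the 2^j subfunctions obtained by
-- fixing x₁ … x_j, in lexicographic order of the fixed values (only
-- meaningful for j ≤ N, which every lemma below assumes).
blocks : (j : ℕ) {N : ℕ} → BoolFun N → List (List Bool)
blocks zero    f = T f ∷ []
blocks (suc j) {zero}  f = []
blocks (suc j) {suc N} f = blocks j (cofactor false f) ++ blocks j (cofactor true f)

concat-blocks : (j : ℕ) {N : ℕ} (f : BoolFun N) → j ≤ N → T f ≡ concat (blocks j f)
concat-blocks zero    f _ = sym (++-identityʳ (T f))
concat-blocks (suc j) {suc N} f (s≤s j≤N) = begin
  T f                                                   ≡⟨ T-cofactors f ⟩
  T (cofactor false f) ++ T (cofactor true f)           ≡⟨ cong₂ _++_ (concat-blocks j _ j≤N) (concat-blocks j _ j≤N) ⟩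
  concat (blocks j (cofactor false f)) ++ concat (blocks j (cofactor true f))
                                                        ≡⟨ concat-++ (blocks j _) (blocks j _) ⟩
  concat (blocks (suc j) f)                             ∎

length-blocks : (j : ℕ) {N : ℕ} (f : BoolFun N) → j ≤ N → length (blocks j f) ≡ 2 ^ j
length-blocks zero    f _ = refl
length-blocks (suc j) {suc N} f (s≤s j≤N) =
  trans (length-++ (blocks j (cofactor false f)))
        (cong₂ _+_ (length-blocks j _ j≤N)
                    (trans (length-blocks j _ j≤N) (sym (*-identityˡ (2 ^ j)))))

blocks-size : (j : ℕ) {N : ℕ} (f : BoolFun N) → j ≤ N →
  All (λ b → length b ≡ 2 ^ (N ∸ j)) (blocks j f)
blocks-size zero    f _ = length-T f ∷ []
blocks-size (suc j) {suc N} f (s≤s j≤N) = ++⁺ (blocks-size j _ j≤N) (blocks-size j _ j≤N)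

pieces≡blocks : (j : ℕ) {N : ℕ} (f : BoolFun N) → j ≤ N → pieces j f ≡ blocks j f
pieces≡blocks j {N} f j≤N = begin
  chunks (2 ^ j) ((length (T f) / 2 ^ j) {{m^n≢0 2 j}}) (T f)
    ≡⟨ cong (λ s → chunks (2 ^ j) s (T f)) piece-size ⟩
  chunks (2 ^ j) (2 ^ (N ∸ j)) (T f)
    ≡⟨ cong₂ (λ k xs → chunks k (2 ^ (N ∸ j)) xs) (sym (length-blocks j f j≤N)) (concat-blocks j f j≤N) ⟩
  chunks (length (blocks j f)) (2 ^ (N ∸ j)) (concat (blocks j f))
    ≡⟨ chunks-concat (blocks j f) _ (blocks-size j f j≤N) ⟩
  blocks j f ∎
  where
  table-size : length (T f) ≡ 2 ^ (N ∸ j) * 2 ^ j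
  table-size = trans (length-T f)
    (trans (cong (2 ^_) (sym (m∸n+n≡m j≤N))) (^-distribˡ-+-* 2 (N ∸ j) j))
  piece-size : (length (T f) / 2 ^ j) {{m^n≢0 2 j}} ≡ 2 ^ (N ∸ j)
  piece-size = trans (cong (λ x → (x / 2 ^ j) {{m^n≢0 2 j}}) table-size)
                     (m*n/n≡m (2 ^ (N ∸ j)) (2 ^ j) {{m^n≢0 2 j}})

-- Deleting the coordinate at position k (counted from 0; an out-of-range
-- position deletes the last coordinate).
deleteAt : {A : Set} {N : ℕ} → ℕ → Vec A (suc N) → Vec A N
deleteAt zero    (x ∷ v)     = v
deleteAt (suc k) (x ∷ [])    = []
deleteAt (suc k) (x ∷ y ∷ v) = x ∷ deleteAt k (y ∷ v)

-- If f ignores coordinate j and equals g after deleting it, then every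
-- j-block of g occurs twice in succession among the j-blocks of f: fixing
-- x₁ … x_j leaves a function that ignores its first variable.
blocks-deleteAt : (j : ℕ) {N : ℕ} (f : BoolFun (suc N)) (g : BoolFun N) → j ≤ N →
  (∀ v → f v ≡ g (deleteAt j v)) → concat (blocks j f) ≡ doublePieces (blocks j g)
blocks-deleteAt zero {N} f g _ f≡g = begin
  T f ++ []                                   ≡⟨ ++-identityʳ (T f) ⟩
  T f                                         ≡⟨ T-cofactors f ⟩
  T (cofactor false f) ++ T (cofactor true f) ≡⟨ cong₂ _++_ (ignores false) (ignores true) ⟩
  T g ++ T g                                  ≡⟨ sym (++-identityʳ (T g ++ T g)) ⟩
  (T g ++ T g) ++ []                          ∎
  where
  ignores : (b : Bool) → T (cofactor b f) ≡ T g
  ignores b = map-cong (λ v → f≡g (b ∷ v)) (lexVecs N)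
blocks-deleteAt (suc j) {suc N} f g (s≤s j≤N) f≡g = begin
  concat (blocks j (cofactor false f) ++ blocks j (cofactor true f))
    ≡⟨ sym (concat-++ (blocks j _) (blocks j _)) ⟩
  concat (blocks j (cofactor false f)) ++ concat (blocks j (cofactor true f))
    ≡⟨ cong₂ _++_ (cofactors-delete false) (cofactors-delete true) ⟩
  doublePieces (blocks j (cofactor false g)) ++ doublePieces (blocks j (cofactor true g))
    ≡⟨ sym (doublePieces-++ (blocks j _) (blocks j _)) ⟩
  doublePieces (blocks (suc j) g) ∎
  where
  cofactors-delete : (b : Bool) →
    concat (blocks j (cofactor b f)) ≡ doublePieces (blocks j (cofactor b g))
  cofactors-delete b = blocks-deleteAt j _ _ j≤N (cofactor-deleteAt b)
    where
    cofactor-deleteAt : (b : Bool) (v : Vec Bool (suc N)) →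
      cofactor b f v ≡ cofactor b g (deleteAt j v)
    cofactor-deleteAt b (y ∷ v) = f≡g (b ∷ y ∷ v)

T-deleteAt : (j : ℕ) {N : ℕ} (f : BoolFun (suc N)) (g : BoolFun N) → j ≤ N →
  (∀ v → f v ≡ g (deleteAt j v)) → T f ≡ doublePieces (pieces j g)
T-deleteAt j {N} f g j≤N f≡g = begin
  T f                          ≡⟨ concat-blocks j f (≤-trans j≤N (n≤1+n N)) ⟩
  concat (blocks j f)          ≡⟨ blocks-deleteAt j f g j≤N f≡g ⟩
  doublePieces (blocks j g)    ≡⟨ cong doublePieces (sym (pieces≡blocks j g j≤N)) ⟩
  doublePieces (pieces j g)    ∎

var-deleteAt-before : {N : ℕ} (i k : ℕ) (v : Vec Bool (suc N)) → i < k → k ≤ N →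
  var (suc i) v ≡ var (suc i) (deleteAt k v)
var-deleteAt-before zero    (suc k) (x ∷ y ∷ v) _         _         = refl
var-deleteAt-before (suc i) (suc k) (x ∷ y ∷ v) (s≤s i<k) (s≤s k≤N) =
  var-deleteAt-before i k (y ∷ v) i<k k≤N

var-deleteAt-after : {N : ℕ} (i k : ℕ) (v : Vec Bool (suc N)) → k ≤ i → k ≤ N →
  var (suc (suc i)) v ≡ var (suc i) (deleteAt k v)
var-deleteAt-after i       zero    (x ∷ v)     _         _         = refl
var-deleteAt-after (suc i) (suc k) (x ∷ y ∷ v) (s≤s k≤i) (s≤s k≤N) =
  var-deleteAt-after i k (y ∷ v) k≤i k≤N

-- For 1 ≤ j+1 ≤ N and a ≤ N, h̃^{N+1}_{j+1} ignores x_{j+2} (position j+1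
-- counted from 0), and deleting that variable yields h̃^N_{j+1}.
htilde-deleteAt : (a j N : ℕ) → a ≤ N → suc j ≤ N → (v : Vec Bool (suc N)) →
  htilde a (suc j) (suc N) v ≡ htilde a (suc j) N (deleteAt (suc j) v)
htilde-deleteAt a j N a≤N sj≤N v =
  cong₂ _∧_ (var-deleteAt-before j (suc j) v (n<1+n j) sj≤N)
            (trans (cong (λ k → var k v) shifted-index) second-variable)
  where
  -- the second variable of h̃^N_{j+1} is x_m, and that of h̃^{N+1}_{j+1} is x_{m+1}
  m : ℕ
  m = N ∸ a + 1 + suc j
  shifted-index : suc N ∸ a + 1 + suc j ≡ suc m
  shifted-index = cong (λ k → k + 1 + suc j) (+-∸-assoc 1 a≤N)
  -- m = i + 1 with i ≥ j + 1, so x_m comes after the deleted variable x_{j+2}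
  i : ℕ
  i = N ∸ a + suc j
  m≡suc-i : m ≡ suc i
  m≡suc-i = cong (_+ suc j) (+-comm (N ∸ a) 1)
  second-variable : var (suc m) v ≡ var m (deleteAt (suc j) v)
  second-variable = begin
    var (suc m) v                    ≡⟨ cong (λ k → var (suc k) v) m≡suc-i ⟩
    var (suc (suc i)) v              ≡⟨ var-deleteAt-after i (suc j) v (m≤n+m (suc j) (N ∸ a)) sj≤N ⟩
    var (suc i) (deleteAt (suc j) v) ≡⟨ cong (λ k → var k (deleteAt (suc j) v)) (sym m≡suc-i) ⟩
    var m (deleteAt (suc j) v)       ∎

lemma5 : (a n : ℕ) → 2 ≤ a → a < n → (j : ℕ) → 1 ≤ j → j ≤ a ∸ 1 →
    T (htilde a j n) ≡ doublePieces (pieces j (htilde a j (n ∸ 1)))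
lemma5 a (suc N) _ (s≤s a≤N) (suc j) _ j≤a∸1 =
  T-deleteAt (suc j) _ _ sj≤N (htilde-deleteAt a j N a≤N sj≤N)
  where
  sj≤N : suc j ≤ N
  sj≤N = ≤-trans (≤-trans j≤a∸1 (m∸n≤m a 1)) a≤N
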